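{- Let $\mathbf{A}$ be a normal and quasicomplemented distributive nearlattice and let $F,G$ be $\alpha$-filters of $A$. Then \[ \alpha(F\veebar G)=\{x\in A\colon \exists (f,g)\in F\times G\ [\,x\in (f^{\top}\cap g^{\top})^{\top}\,]\}. \]
   Context: A distributive nearlattice is a join-semilattice $\langle A,\vee,1\rangle$ with greatest element $1$ in which every principal filter $[a)=\{x\in A\colon a\le x\}$ is a bounded distributive lattice. A filter of $A$ is a subset containing $1$, upward closed, and closed under those binary meets $a\wedge b$ that exist in $A$. For filters $F,G$, $F\veebar G$ is the smallest filter containing $F\cup G$ (it consists of all existing meets $x_1\wedge\dots\wedge x_n$ of elements $x_i$ lying above some element of $F\cup G$). For $a\in A$, $a^{\top}=\{x\in A\colon x\vee a=1\}$ and $a^{\top\top}=\{y\in A\colon y\vee x=1\text{ for all }x\in a^{\top}\}$; for a filter $H$, $H^{\top}=\{x\in A\colon x\vee h=1\text{ for all }h\in H\}$ (so $(f^{\top}\cap g^{\top})^{\top}$ is this applied to the filter $f^{\top}\cap g^{\top}$). A filter $F$ is an $\alpha$-filter if $a^{\top\top}\subseteq F$ for all $a\in F$. For a filter $H$, $\alpha(H)=\{x\in A\colon \exists a\in H\ (a^{\top}\subseteq x^{\top})\}$ (in a normal distributive nearlattice this is the smallest $\alpha$-filter containing $H$). A prime ideal is a non-empty proper downward closed, $\vee$-closed subset $P$ with $a\wedge b\in P\Rightarrow a\in P$ or $b\in P$ whenever $a\wedge b$ exists; a maximal ideal is a maximal proper non-empty such subset (ideal). $\mathbf{A}$ is normal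 if each prime ideal is contained in a unique maximal ideal; $\mathbf{A}$ is quasicomplemented if for each $a\in A$ there exists $b\in A$ with $a^{\top\top}=b^{\top}$. -}

module Defs where

open import Level using (0ℓ; suc)
open import Data.Product using (Σ; ∃; ∃-syntax; _×_; _,_)
open import Data.Sum using (_⊎_)
open import Data.Empty using (⊥)
open import Relation.Nullary using (¬_)
open import Relation.Unary using (Pred; _∈_; _∉_; _⊆_; _∩_)
open import Relation.Binary.PropositionalEquality using (_≡_)

record JoinSemilattice₁ : Set₁ where
  infixr 6 _∨_
  infix 4 _≤_
  field
    Carrier : Set
    _∨_     : Carrier → Carrier → Carrier
    𝟏       : Carrier
    ∨-assoc : ∀ x y z → (x ∨ y) ∨ z ≡ x ∨ (y ∨ z)
    ∨-comm  : ∀ x y → x ∨ y ≡ y ∨ x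
    ∨-idem  : ∀ x → x ∨ x ≡ x
    ∨-top   : ∀ x → x ∨ 𝟏 ≡ 𝟏

  _≤_ : Carrier → Carrier → Set
  x ≤ y = x ∨ y ≡ y

  IsMeet : Carrier → Carrier → Carrier → Set
  IsMeet a b m = (m ≤ a) × (m ≤ b) × (∀ c → c ≤ a → c ≤ b → c ≤ m)

  IsMeetIn : Carrier → Carrier → Carrier → Carrier → Set
  IsMeetIn a x y m = (a ≤ m) × (m ≤ x) × (m ≤ y)
                     × (∀ c → a ≤ c → c ≤ x → c ≤ y → c ≤ m)

-- Distributive nearlattice: every principal filter [a) is a bounded
-- distributive lattice (bounds a and 1, join ∨, meet the relative glb).
record DistributiveNearlattice : Set₁ where
  field
    jsl : JoinSemilattice₁
  open JoinSemilattice₁ jsl public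
  field
    principal-meet : ∀ a x y → a ≤ x → a ≤ y → ∃[ m ] IsMeetIn a x y m
    principal-distrib : ∀ a x y z m₁ m₂ m →
      a ≤ x → a ≤ y → a ≤ z →
      IsMeetIn a x y m₁ → IsMeetIn a x z m₂ → IsMeetIn a x (y ∨ z) m →
      m ≡ m₁ ∨ m₂

module _ (𝐀 : DistributiveNearlattice) where
  open DistributiveNearlattice 𝐀

  Subset : Set₁
  Subset = Pred Carrier 0ℓ

  _≐_ : Subset → Subset → Set
  S ≐ T = (S ⊆ T) × (T ⊆ S)

  record IsFilter (F : Subset) : Set where
    field
      top∈   : 𝟏 ∈ F
      upward : ∀ {x y} → x ≤ y → x ∈ F → y ∈ F
      meet∈  : ∀ {a b m} → IsMeet a b m → a ∈ F → b ∈ F → m ∈ F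

  data _⊻_ (F G : Subset) : Subset where
    inF  : ∀ {x} → x ∈ F → x ∈ (F ⊻ G)
    inG  : ∀ {x} → x ∈ G → x ∈ (F ⊻ G)
    top  : 𝟏 ∈ (F ⊻ G)
    up   : ∀ {x y} → x ≤ y → x ∈ (F ⊻ G) → y ∈ (F ⊻ G)
    meet : ∀ {a b m} → IsMeet a b m → a ∈ (F ⊻ G) → b ∈ (F ⊻ G) → m ∈ (F ⊻ G)

  _ᵀ : Carrier → Subset
  (a ᵀ) x = x ∨ a ≡ 𝟏

  _ᵀˢ : Subset → Subset
  (H ᵀˢ) x = ∀ h → h ∈ H → x ∨ h ≡ 𝟏

  _ᵀᵀ : Carrier → Subset
  (a ᵀᵀ) y = ∀ x → x ∈ (a ᵀ) → y ∨ x ≡ 𝟏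

  IsαFilter : Subset → Set
  IsαFilter F = IsFilter F × (∀ a → a ∈ F → (a ᵀᵀ) ⊆ F)

  α : Subset → Subset
  α H x = ∃[ a ] (a ∈ H × (a ᵀ) ⊆ (x ᵀ))

  record IsIdeal (I : Subset) : Set where
    field
      nonempty : ∃[ x ] x ∈ I
      proper   : ∃[ x ] x ∉ I
      downward : ∀ {x y} → x ≤ y → y ∈ I → x ∈ I
      join∈    : ∀ {x y} → x ∈ I → y ∈ I → (x ∨ y) ∈ I

  IsPrimeIdeal : Subset → Set
  IsPrimeIdeal P = IsIdeal P × (∀ a b m → IsMeet a b m → m ∈ P → a ∈ P ⊎ b ∈ P)

  IsMaximalIdeal : Subset → Set₁
  IsMaximalIdeal M = IsIdeal M × (∀ J → IsIdeal J → M ⊆ J → J ⊆ M)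

  Normal : Set₁
  Normal = ∀ P → IsPrimeIdeal P →
    Σ Subset λ M → IsMaximalIdeal M × P ⊆ M ×
      (∀ M' → IsMaximalIdeal M' → P ⊆ M' → M' ≐ M)

  Quasicomplemented : Set
  Quasicomplemented = ∀ a → ∃[ b ] ((a ᵀᵀ) ≐ (b ᵀ))

-- Call a covered if fᵀ ∩ gᵀ ⊆ aᵀ for some f ∈ F and g ∈ G. The covered elements form a filter
-- containing F ∪ G, hence F ⊻ G: closure under a meet m = a ∧ b rests on aᵀ ∩ bᵀ ⊆ mᵀ, which is
-- where distributivity enters, and on replacing f₁, f₂ by the meet of f₁ ∨ m and f₂ ∨ m in [m).
-- Conversely, if fᵀ ∩ gᵀ ⊆ xᵀ, then the meet a of f ∨ x and g ∨ x in [x) lies in F ⊻ G and has aᵀ ⊆ xᵀ.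

module Submission where

open import Data.Product using (∃-syntax; _×_; _,_; proj₁; proj₂)
open import Relation.Unary using (_∈_; _∩_; _⊆_)
open import Relation.Binary.PropositionalEquality using (_≡_; sym; trans; cong; subst; module ≡-Reasoning)
import Defs
open Defs using (DistributiveNearlattice; IsFilter; inF; inG; top; up; meet)

module Nearlattice (𝐀 : DistributiveNearlattice) where
  open DistributiveNearlattice 𝐀

  Subset : Set₁
  Subset = Defs.Subset 𝐀

  _ᵀ : Carrier → Subset
  _ᵀ = Defs._ᵀ 𝐀

  _ᵀˢ : Subset → Subset
  _ᵀˢ = Defs._ᵀˢ 𝐀

  _⊻_ : Subset → Subset → Subset
  _⊻_ = Defs._⊻_ 𝐀

  α : Subset → Subset
  α = Defs.α 𝐀

  ≤-refl : ∀ x → x ≤ x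
  ≤-refl = ∨-idem

  ≤-trans : ∀ {x y z} → x ≤ y → y ≤ z → x ≤ z
  ≤-trans {x} {y} {z} x≤y y≤z = begin
    x ∨ z        ≡⟨ cong (x ∨_) (sym y≤z) ⟩
    x ∨ (y ∨ z)  ≡⟨ sym (∨-assoc x y z) ⟩
    (x ∨ y) ∨ z  ≡⟨ cong (_∨ z) x≤y ⟩
    y ∨ z        ≡⟨ y≤z ⟩
    z            ∎
    where open ≡-Reasoning

  x≤x∨y : ∀ x y → x ≤ x ∨ y
  x≤x∨y x y = trans (sym (∨-assoc x x y)) (cong (_∨ y) (∨-idem x))

  y≤x∨y : ∀ x y → y ≤ x ∨ y
  y≤x∨y x y = subst (y ≤_) (∨-comm y x) (x≤x∨y y x)

  ∨-least : ∀ {x y z} → x ≤ z → y ≤ z → x ∨ y ≤ z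
  ∨-least {x} {y} {z} x≤z y≤z = trans (∨-assoc x y z) (trans (cong (x ∨_) y≤z) x≤z)

  ∈ᵀ-sym : ∀ {x y} → x ∈ y ᵀ → y ∈ x ᵀ
  ∈ᵀ-sym {x} {y} x∨y≡𝟏 = trans (∨-comm y x) x∨y≡𝟏

  ᵀ-upward : ∀ {u y z} → y ≤ z → y ∈ u ᵀ → z ∈ u ᵀ
  ᵀ-upward {u} {y} {z} y≤z y∨u≡𝟏 = begin
    z ∨ u        ≡⟨ cong (_∨ u) (sym y≤z) ⟩
    (y ∨ z) ∨ u  ≡⟨ cong (_∨ u) (∨-comm y z) ⟩
    (z ∨ y) ∨ u  ≡⟨ ∨-assoc z y u ⟩
    z ∨ (y ∨ u)  ≡⟨ cong (z ∨_) y∨u≡𝟏 ⟩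
    z ∨ 𝟏        ≡⟨ ∨-top z ⟩
    𝟏            ∎
    where open ≡-Reasoning

  ᵀ-mono : ∀ {u v} → u ≤ v → u ᵀ ⊆ v ᵀ
  ᵀ-mono u≤v y∈uᵀ = ∈ᵀ-sym (ᵀ-upward u≤v (∈ᵀ-sym y∈uᵀ))

  ∈ᵀ-above⇒≡𝟏 : ∀ {a x} → a ≤ x → x ∈ a ᵀ → x ≡ 𝟏
  ∈ᵀ-above⇒≡𝟏 {a} {x} a≤x x∨a≡𝟏 = trans (sym a≤x) (∈ᵀ-sym x∨a≡𝟏)

  ∈ᵀ-∨-shift : ∀ {y f m} → y ∈ (f ∨ m) ᵀ → y ∨ m ∈ f ᵀ
  ∈ᵀ-∨-shift {y} {f} {m} y∨[f∨m]≡𝟏 =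
    trans (∨-assoc y m f) (trans (cong (y ∨_) (∨-comm m f)) y∨[f∨m]≡𝟏)

  ∈ᵀˢ⇒⊆ᵀ : ∀ {S x} → x ∈ S ᵀˢ → S ⊆ x ᵀ
  ∈ᵀˢ⇒⊆ᵀ x∈Sᵀ {y} y∈S = ∈ᵀ-sym (x∈Sᵀ y y∈S)

  ⊆ᵀ⇒∈ᵀˢ : ∀ {S x} → S ⊆ x ᵀ → x ∈ S ᵀˢ
  ⊆ᵀ⇒∈ᵀˢ S⊆xᵀ y y∈S = ∈ᵀ-sym (S⊆xᵀ y∈S)

  meetIn⇒meet : ∀ {m x y k} → IsMeetIn m x y k → IsMeet x y k
  meetIn⇒meet {m} (m≤k , k≤x , k≤y , glb) = k≤x , k≤y , λ c c≤x c≤y →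
    ≤-trans (x≤x∨y c m)
      (glb (c ∨ m) (y≤x∨y c m)
           (∨-least c≤x (≤-trans m≤k k≤x)) (∨-least c≤y (≤-trans m≤k k≤y)))

  ᵀ-∩-meet : ∀ {a b m} → IsMeet a b m → a ᵀ ∩ b ᵀ ⊆ m ᵀ
  ᵀ-∩-meet {a} {b} {m} (m≤a , m≤b , glb) {y} (y∈aᵀ , y∈bᵀ) =
    ∈ᵀ-above⇒≡𝟏 a≤x (ᵀ-upward y≤x y∈aᵀ)
    where
    x = y ∨ m
    y≤x = x≤x∨y y m
    m≤x = y≤x∨y y m
    a∧x = proj₁ (principal-meet m a x m≤a m≤x)
    a∧x-meet = proj₂ (principal-meet m a x m≤a m≤x)
    a∧b-meet : IsMeetIn m a b m
    a∧b-meet = ≤-refl m , m≤a , m≤b , λ c _ → glb c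
    a∧[x∨b]-meet : IsMeetIn m a (x ∨ b) a
    a∧[x∨b]-meet = subst (λ t → IsMeetIn m a t a) (sym (ᵀ-upward y≤x y∈bᵀ))
                         (m≤a , ≤-refl a , ∨-top a , λ c _ c≤a _ → c≤a)
    -- Distributivity of [m): a = a ∧ (x ∨ b) = (a ∧ x) ∨ (a ∧ b) = (a ∧ x) ∨ m ≤ x.
    a≡[a∧x]∨m : a ≡ a∧x ∨ m
    a≡[a∧x]∨m = principal-distrib m a x b a∧x m a m≤a m≤x m≤b
                  a∧x-meet a∧b-meet a∧[x∨b]-meet
    a≤x : a ≤ x
    a≤x = subst (_≤ x) (sym a≡[a∧x]∨m) (∨-least (proj₁ (proj₂ (proj₂ a∧x-meet))) m≤x)

  -- The meet of f ∨ m and g ∨ m in the lattice [m); it exists although f ∧ g need not.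
  _∧⟨_⟩_ : Carrier → Carrier → Carrier → Carrier
  f ∧⟨ m ⟩ g = proj₁ (principal-meet m (f ∨ m) (g ∨ m) (y≤x∨y f m) (y≤x∨y g m))

  ∧⟨⟩-isMeet : ∀ f m g → IsMeet (f ∨ m) (g ∨ m) (f ∧⟨ m ⟩ g)
  ∧⟨⟩-isMeet f m g =
    meetIn⇒meet (proj₂ (principal-meet m (f ∨ m) (g ∨ m) (y≤x∨y f m) (y≤x∨y g m)))

  ∧⟨⟩-ᵀ : ∀ {f m g y} → y ∈ (f ∧⟨ m ⟩ g) ᵀ → y ∨ m ∈ f ᵀ ∩ g ᵀ
  ∧⟨⟩-ᵀ {f} {m} {g} y∈ᵀ =
    ∈ᵀ-∨-shift (ᵀ-mono k≤f∨m y∈ᵀ) , ∈ᵀ-∨-shift (ᵀ-mono k≤g∨m y∈ᵀ)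
    where
    k≤f∨m = proj₁ (∧⟨⟩-isMeet f m g)
    k≤g∨m = proj₁ (proj₂ (∧⟨⟩-isMeet f m g))

  ∧⟨⟩-∈ : ∀ {H f g} → IsFilter 𝐀 H → f ∈ H → g ∈ H → ∀ m → f ∧⟨ m ⟩ g ∈ H
  ∧⟨⟩-∈ {f = f} {g} H-filter f∈H g∈H m =
    meet∈ (∧⟨⟩-isMeet f m g) (upward (x≤x∨y f m) f∈H) (upward (x≤x∨y g m) g∈H)
    where open IsFilter H-filter

  ⊻-isFilter : ∀ {F G} → IsFilter 𝐀 (F ⊻ G)
  ⊻-isFilter = record { top∈ = top ; upward = up ; meet∈ = meet }

  module _ {F G : Subset} (F-filter : IsFilter 𝐀 F) (G-filter : IsFilter 𝐀 G) where

    Covered : Subset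
    Covered a = ∃[ f ] ∃[ g ] (f ∈ F × g ∈ G × f ᵀ ∩ g ᵀ ⊆ a ᵀ)

    ⊻⊆Covered : F ⊻ G ⊆ Covered
    ⊻⊆Covered (inF {f} f∈F) = f , 𝟏 , f∈F , IsFilter.top∈ G-filter , proj₁
    ⊻⊆Covered (inG {g} g∈G) = 𝟏 , g , IsFilter.top∈ F-filter , g∈G , proj₂
    ⊻⊆Covered top = 𝟏 , 𝟏 , IsFilter.top∈ F-filter , IsFilter.top∈ G-filter , proj₁
    ⊻⊆Covered (up x≤y x∈F⊻G) with ⊻⊆Covered x∈F⊻G
    ... | f , g , f∈F , g∈G , cover = f , g , f∈F , g∈G , λ y∈ → ᵀ-mono x≤y (cover y∈)
    ⊻⊆Covered (meet {a} {b} {m} m-meet a∈F⊻G b∈F⊻G)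
      with ⊻⊆Covered a∈F⊻G | ⊻⊆Covered b∈F⊻G
    ... | f₁ , g₁ , f₁∈F , g₁∈G , cover₁ | f₂ , g₂ , f₂∈F , g₂∈G , cover₂ =
      f₁ ∧⟨ m ⟩ f₂ , g₁ ∧⟨ m ⟩ g₂ ,
      ∧⟨⟩-∈ F-filter f₁∈F f₂∈F m , ∧⟨⟩-∈ G-filter g₁∈G g₂∈G m , cover
      where
      cover : (f₁ ∧⟨ m ⟩ f₂) ᵀ ∩ (g₁ ∧⟨ m ⟩ g₂) ᵀ ⊆ m ᵀ
      cover {y} (y∈fᵀ , y∈gᵀ) with ∧⟨⟩-ᵀ y∈fᵀ | ∧⟨⟩-ᵀ y∈gᵀ
      ... | y∨m∈f₁ᵀ , y∨m∈f₂ᵀ | y∨m∈g₁ᵀ , y∨m∈g₂ᵀ =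
        ∈ᵀ-above⇒≡𝟏 (y≤x∨y y m)
          (ᵀ-∩-meet m-meet (cover₁ (y∨m∈f₁ᵀ , y∨m∈g₁ᵀ) , cover₂ (y∨m∈f₂ᵀ , y∨m∈g₂ᵀ)))

    α⊻⊆ : α (F ⊻ G) ⊆ λ x → ∃[ f ] ∃[ g ] (f ∈ F × g ∈ G × x ∈ (f ᵀ ∩ g ᵀ) ᵀˢ)
    α⊻⊆ (a , a∈F⊻G , aᵀ⊆xᵀ) with ⊻⊆Covered a∈F⊻G
    ... | f , g , f∈F , g∈G , cover = f , g , f∈F , g∈G , ⊆ᵀ⇒∈ᵀˢ (λ y∈ → aᵀ⊆xᵀ (cover y∈))

    ⊆α⊻ : (λ x → ∃[ f ] ∃[ g ] (f ∈ F × g ∈ G × x ∈ (f ᵀ ∩ g ᵀ) ᵀˢ)) ⊆ α (F ⊻ G)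
    ⊆α⊻ {x} (f , g , f∈F , g∈G , x∈[fᵀ∩gᵀ]ᵀ) =
      f ∧⟨ x ⟩ g , ∧⟨⟩-∈ ⊻-isFilter (inF f∈F) (inG g∈G) x ,
      λ y∈ → ∈ᵀ-above⇒≡𝟏 (y≤x∨y _ x) (∈ᵀˢ⇒⊆ᵀ x∈[fᵀ∩gᵀ]ᵀ (∧⟨⟩-ᵀ y∈))

open Defs using (Subset; _≐_; α; _⊻_; _ᵀ; _ᵀˢ; IsαFilter; Normal; Quasicomplemented)

theorem3p11 : (𝐀 : DistributiveNearlattice) → Normal 𝐀 → Quasicomplemented 𝐀 →
    (F G : Subset 𝐀) → IsαFilter 𝐀 F → IsαFilter 𝐀 G →
    _≐_ 𝐀 (α 𝐀 (_⊻_ 𝐀 F G))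
      (λ x → ∃[ f ] ∃[ g ] (f ∈ F × g ∈ G × x ∈ _ᵀˢ 𝐀 (_ᵀ 𝐀 f ∩ _ᵀ 𝐀 g)))
theorem3p11 𝐀 _ _ F G (F-filter , _) (G-filter , _) =
  Nearlattice.α⊻⊆ 𝐀 F-filter G-filter , Nearlattice.⊆α⊻ 𝐀 F-filter G-filter
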